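{- Let $Y$ be a string and $K \ge 1$ an integer, and write $Y_s = Y[K+s \,..\, |Y|-K+s)$. If $\mathrm{bp}_{4K}(Y) > 10K$, then for all $s, s' \in \{ -K, \dots, K\}$: \[ \mathrm{ED}(Y_s, Y_{s'}) = 2 \cdot |s - s'|. \]
   Context: Strings are indexed from $0$; $Y[i..j)$ denotes $Y[i]\cdots Y[j-1]$. $\mathrm{ED}$ is edit distance. For a string $P$, $P^*$ is the infinite repetition of $P$; a string $Z$ is periodic with period $P$ if $Z = P^*[0..|Z|)$, and $Z$ is $p$-periodic if it is periodic with some period of length at most $p$. The $K$-block periodicity $\mathrm{bp}_K(Y)$ is the smallest integer $L$ such that $Y$ can be written as a concatenation $Y = Y_1 \circ \cdots \circ Y_L$ of $L$ substrings each of which is $K$-periodic. -}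

module Defs where

open import Data.Nat using (ℕ; zero; suc; _+_; _∸_; _≤_; _⊔_; _⊓_)
open import Data.Integer as ℤ using (ℤ; ∣_∣)
open import Data.List using (List; []; _∷_; length; take; drop; concat; replicate)
open import Data.List.Relation.Unary.All using (All)
open import Data.Product using (Σ; _×_)
open import Relation.Binary.PropositionalEquality using (_≡_)
open import Relation.Binary.Definitions using (DecidableEquality)
open import Relation.Nullary using (yes; no)

module _ {A : Set} (_≟_ : DecidableEquality A) where

  ED : List A → List A → ℕ
  ED [] ys = length ys
  ED (x ∷ xs) [] = suc (length xs)
  ED (x ∷ xs) (y ∷ ys) =
    suc (ED xs (y ∷ ys)) ⊓ suc (ED (x ∷ xs) ys) ⊓ (ED xs ys + mismatch)
    where
    mismatch : ℕ
    mismatch with x ≟ y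
    ... | yes _ = 0
    ... | no _ = 1

module _ {A : Set} where

  slice : List A → ℕ → ℕ → List A
  slice Y i j = take (j ∸ i) (drop i Y)

  -- P*[0..n) : the length-n prefix of the infinite repetition of P
  -- (n copies of P suffice when P is nonempty).
  powPrefix : List A → ℕ → List A
  powPrefix P n = take n (concat (replicate n P))

  -- Z is periodic with period P (P nonempty, so that P* is defined)
  PeriodicWith : List A → List A → Set
  PeriodicWith P Z = (1 ≤ length P) × (Z ≡ powPrefix P (length Z))

  IsPeriodic : ℕ → List A → Set
  IsPeriodic p Z = Σ (List A) λ P → (length P ≤ p) × PeriodicWith P Z

  BlockDecomposition : ℕ → List A → ℕ → Set
  BlockDecomposition K Y L =
    Σ (List (List A)) λ Ys → (length Ys ≡ L) × (concat Ys ≡ Y) × All (IsPeriodic K) Ys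

  IsBlockPeriodicity : ℕ → List A → ℕ → Set
  IsBlockPeriodicity K Y L =
    BlockDecomposition K Y L × (∀ L′ → BlockDecomposition K Y L′ → L ≤ L′)

  shifted : List A → ℕ → ℤ → List A
  shifted Y K s =
    slice Y ∣ ℤ.+ K ℤ.+ s ∣ ∣ (ℤ.+ length Y ℤ.- ℤ.+ K) ℤ.+ s ∣

{-# OPTIONS --safe #-}
module Submission where

open import Defs
open import Data.Nat using (ℕ; zero; suc; _+_; _*_; _∸_; _<_; _≤_; _⊓_; z≤n; s≤s; s≤s⁻¹; ∣_-_∣)
open import Data.Nat.Properties
open import Data.Nat.Tactic.RingSolver using (solve-∀)
open import Data.Integer as ℤ using (ℤ; ∣_∣; _⊖_)
import Data.Integer.Properties as ℤ
open import Data.Integer.Tactic.RingSolver using () renaming (solve-∀ to ℤ-solve-∀)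
open import Data.List using (List; []; _∷_; length; take; drop; concat; replicate; _++_)
open import Data.List.Properties
  using ( length-++; length-take; length-drop; drop-drop; take++drop≡id; take-take; take-all
        ; take-[]; drop-[]; concat-++; ++-assoc; ++-identityʳ)
open import Data.List.Relation.Unary.All using ([]; _∷_)
open import Data.List.Relation.Unary.All.Properties using (++⁺)
open import Data.Product using (∃-syntax; _×_; _,_)
open import Data.Sum using (inj₁; inj₂; [_,_]′)
open import Data.Empty using (⊥-elim)
open import Relation.Binary.PropositionalEquality
open import Relation.Binary.Definitions using (DecidableEquality)
open import Relation.Nullary using (yes; no)

-- Write Y_{s′} = V[0..N) and Y_s = U[0..N) with U = V[d..), d = s − s′ ≥ 0. Deleting the first d
-- characters of V and appending the last d of U gives ED ≤ 2d. Conversely, follow the edit-distance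
-- recurrence on U[0..i), V[0..j) while tracking the shift δ with U = V[δ..): a deletion or an
-- insertion moves δ by one, and a run of matches at shift δ is a stretch on which U agrees with
-- V = V[..δ) ++ U, hence a δ-periodic block. Every unit-cost step closes at most two blocks, so an
-- alignment of cost c < 2d cuts Y into at most 2c + 3 ≤ 8K + 1 blocks of period ≤ 4K,
-- contradicting bp_{4K}(Y) > 10K.

⊓₃-elim : (P : ℕ → Set) → ∀ {a b c} → P a → P b → P c → P (a ⊓ b ⊓ c)
⊓₃-elim P {a} {b} {c} pa pb pc with ⊓-sel (a ⊓ b) c
... | inj₂ eq rewrite eq = pc
... | inj₁ eq rewrite eq with ⊓-sel a b
...   | inj₁ eq′ rewrite eq′ = pa
...   | inj₂ eq′ rewrite eq′ = pb

∣m⊖n∣≡∣m-n∣ : ∀ m n → ∣ m ⊖ n ∣ ≡ ∣ m - n ∣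
∣m⊖n∣≡∣m-n∣ m n with ≤-total m n
... | inj₁ m≤n = trans (ℤ.∣⊖∣-≤ m≤n) (sym (trans (∣-∣-comm m n) (m≤n⇒∣n-m∣≡n∸m m≤n)))
... | inj₂ n≤m = trans (ℤ.∣m⊖n∣≡∣n⊖m∣ m n) (trans (ℤ.∣⊖∣-≤ n≤m) (sym (m≤n⇒∣n-m∣≡n∸m n≤m)))

module _ {A : Set} where

  take-++ˡ : ∀ n (xs ys : List A) → n ≤ length xs → take n (xs ++ ys) ≡ take n xs
  take-++ˡ zero    xs       ys _         = refl
  take-++ˡ (suc n) (x ∷ xs) ys (s≤s n≤) = cong (x ∷_) (take-++ˡ n xs ys n≤)

  take-length+-++ : ∀ (xs ys : List A) m → take (length xs + m) (xs ++ ys) ≡ xs ++ take m ys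
  take-length+-++ []       ys m = refl
  take-length+-++ (x ∷ xs) ys m = cong (x ∷_) (take-length+-++ xs ys m)

  take-++-take : ∀ n (xs ys : List A) m → n ≤ length xs + m → take n (xs ++ take m ys) ≡ take n (xs ++ ys)
  take-++-take n       []       ys m n≤m      = trans (take-take n m ys) (cong (λ k → take k ys) (m≤n⇒m⊓n≡m n≤m))
  take-++-take zero    (x ∷ xs) ys m _        = refl
  take-++-take (suc n) (x ∷ xs) ys m (s≤s n≤) = cong (x ∷_) (take-++-take n xs ys m n≤)

  take-take-≤ : ∀ {m n} (xs : List A) → m ≤ n → take m (take n xs) ≡ take m xs
  take-take-≤ {m} {n} xs m≤n = trans (take-take m n xs) (cong (λ k → take k xs) (m≤n⇒m⊓n≡m m≤n))

  length-take-≤ : ∀ {n} (xs : List A) → n ≤ length xs → length (take n xs) ≡ n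
  length-take-≤ {n} xs n≤ = trans (length-take n xs) (m≤n⇒m⊓n≡m n≤)

  drop-suc-∷ : ∀ n (xs : List A) {y ys} → drop n xs ≡ y ∷ ys → drop (suc n) xs ≡ ys
  drop-suc-∷ zero    xs       eq = cong (drop 1) eq
  drop-suc-∷ (suc n) []       ()
  drop-suc-∷ (suc n) (x ∷ xs) eq = drop-suc-∷ n xs eq

  drop-∷-∷ : ∀ {n} {x y} {xs ys : List A} → 1 ≤ n → drop n (x ∷ xs) ≡ y ∷ ys → drop n xs ≡ ys
  drop-∷-∷ {suc n} {xs = xs} _ eq = drop-suc-∷ n xs eq

  ≤-length-concat-replicate : ∀ k (P : List A) → 1 ≤ length P → k ≤ length (concat (replicate k P))
  ≤-length-concat-replicate zero    P _   = z≤n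
  ≤-length-concat-replicate (suc k) P 1≤P = begin
    suc k                                        ≤⟨ +-monoˡ-≤ k 1≤P ⟩
    length P + k                                 ≤⟨ +-monoʳ-≤ (length P) (≤-length-concat-replicate k P 1≤P) ⟩
    length P + length (concat (replicate k P))   ≡⟨ length-++ P ⟨
    length (concat (replicate (suc k) P))        ∎
    where open ≤-Reasoning

  shift-invariant⇒periodic : ∀ (P R : List A) → 1 ≤ length P → R ≡ take (length R) (P ++ R) → PeriodicWith P R
  shift-invariant⇒periodic P R 1≤P R≡ = 1≤P , (begin
    R                                       ≡⟨ iterate n ⟩
    take n (concat (replicate n P) ++ R)    ≡⟨ take-++ˡ n _ R (≤-length-concat-replicate n P 1≤P) ⟩
    powPrefix P n                           ∎)
    where
    open ≡-Reasoning
    n = length R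
    iterate : ∀ k → R ≡ take n (concat (replicate k P) ++ R)
    iterate zero    = sym (take-all n R ≤-refl)
    iterate (suc k) = begin
      R                                  ≡⟨ R≡ ⟩
      take n (P ++ R)                    ≡⟨ cong (λ Z → take n (P ++ Z)) (iterate k) ⟩
      take n (P ++ take n (Pᵏ ++ R))     ≡⟨ take-++-take n P (Pᵏ ++ R) n (m≤n+m n (length P)) ⟩
      take n (P ++ (Pᵏ ++ R))            ≡⟨ cong (take n) (++-assoc P Pᵏ R) ⟨
      take n ((P ++ Pᵏ) ++ R)            ∎
      where Pᵏ = concat (replicate k P)

  agreeing-shift⇒periodic : ∀ (P U : List A) r → 1 ≤ length P → take r (P ++ U) ≡ take r U →
                            PeriodicWith P (take r U)
  agreeing-shift⇒periodic P U r 1≤P agree = shift-invariant⇒periodic P R 1≤P (sym (begin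
    take n (P ++ R)               ≡⟨ take-++-take n P U r (≤-trans n≤r (m≤n+m r (length P))) ⟩
    take n (P ++ U)               ≡⟨ take-take-≤ (P ++ U) n≤r ⟨
    take n (take r (P ++ U))      ≡⟨ cong (take n) agree ⟩
    take n R                      ≡⟨ take-all n R ≤-refl ⟩
    R                             ∎))
    where
    open ≡-Reasoning
    R = take r U
    n = length R
    n≤r : n ≤ r
    n≤r = ≤-trans (≤-reflexive (length-take r U)) (m⊓n≤m r (length U))

  BlockDecomposition≤ : ℕ → List A → ℕ → Set
  BlockDecomposition≤ D Z k = ∃[ L ] L ≤ k × BlockDecomposition D Z L

  module _ {D : ℕ} where

    blocks-[] : ∀ {k} → BlockDecomposition≤ D [] k
    blocks-[] = 0 , z≤n , [] , refl , refl , []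

    blocks-mono : ∀ {Z k k′} → k ≤ k′ → BlockDecomposition≤ D Z k → BlockDecomposition≤ D Z k′
    blocks-mono k≤k′ (L , L≤k , Ys) = L , ≤-trans L≤k k≤k′ , Ys

    blocks-++ : ∀ {Z₁ Z₂ k₁ k₂} → BlockDecomposition≤ D Z₁ k₁ → BlockDecomposition≤ D Z₂ k₂ →
                BlockDecomposition≤ D (Z₁ ++ Z₂) (k₁ + k₂)
    blocks-++ (L₁ , L₁≤ , Ys₁ , refl , refl , per₁) (L₂ , L₂≤ , Ys₂ , refl , refl , per₂) =
      L₁ + L₂ , +-mono-≤ L₁≤ L₂≤ , Ys₁ ++ Ys₂ , length-++ Ys₁ , sym (concat-++ Ys₁ Ys₂) , ++⁺ per₁ per₂

    blocks-periodic : ∀ {Z} → IsPeriodic D Z → BlockDecomposition≤ D Z 1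
    blocks-periodic {Z} per = 1 , ≤-refl , Z ∷ [] , refl , ++-identityʳ Z , per ∷ []

    blocks-short : ∀ (Z : List A) → length Z ≤ D → BlockDecomposition≤ D Z 1
    blocks-short []      _   = blocks-[]
    blocks-short (z ∷ Z) |Z|≤D = blocks-periodic (z ∷ Z , |Z|≤D ,
      shift-invariant⇒periodic (z ∷ Z) (z ∷ Z) (s≤s z≤n)
        (sym (trans (take-++ˡ _ (z ∷ Z) (z ∷ Z) ≤-refl) (take-all _ (z ∷ Z) ≤-refl))))

    blocks-singletons : 1 ≤ D → ∀ (Z : List A) → BlockDecomposition≤ D Z (length Z)
    blocks-singletons 1≤D []      = blocks-[]
    blocks-singletons 1≤D (z ∷ Z) = blocks-++ {Z₁ = z ∷ []} (blocks-short (z ∷ []) 1≤D) (blocks-singletons 1≤D Z)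

    block-periodicity-minimal : ∀ {Y bp k} → IsBlockPeriodicity D Y bp → BlockDecomposition≤ D Y k → bp ≤ k
    block-periodicity-minimal (_ , minimal) (L , L≤k , decomposition) = ≤-trans (minimal L decomposition) L≤k

    block-periodicity≤length : ∀ {Y bp} → 1 ≤ D → IsBlockPeriodicity D Y bp → bp ≤ length Y
    block-periodicity≤length {Y} 1≤D isBp = block-periodicity-minimal isBp (blocks-singletons 1≤D Y)

module _ {A : Set} (_≟_ : DecidableEquality A) where

  mismatch : A → A → ℕ
  mismatch x y with x ≟ y
  ... | yes _ = 0
  ... | no  _ = 1

  mismatch-refl : ∀ x → mismatch x x ≡ 0
  mismatch-refl x with x ≟ x
  ... | yes _  = refl
  ... | no x≢x = ⊥-elim (x≢x refl)

  mismatch-sym : ∀ x y → mismatch x y ≡ mismatch y x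
  mismatch-sym x y with x ≟ y | y ≟ x
  ... | yes _   | yes _   = refl
  ... | yes x≡y | no  y≢x = ⊥-elim (y≢x (sym x≡y))
  ... | no  x≢y | yes y≡x = ⊥-elim (x≢y (sym y≡x))
  ... | no  _   | no  _   = refl

  ED-∷-∷ : ∀ x xs y ys → ED _≟_ (x ∷ xs) (y ∷ ys) ≡
           suc (ED _≟_ xs (y ∷ ys)) ⊓ suc (ED _≟_ (x ∷ xs) ys) ⊓ (ED _≟_ xs ys + mismatch x y)
  ED-∷-∷ x xs y ys with x ≟ y
  ... | yes _ = refl
  ... | no  _ = refl

  ED-sym : ∀ xs ys → ED _≟_ xs ys ≡ ED _≟_ ys xs
  ED-sym []       []       = refl
  ED-sym []       (y ∷ ys) = refl
  ED-sym (x ∷ xs) []       = refl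
  ED-sym (x ∷ xs) (y ∷ ys) = begin
    ED _≟_ (x ∷ xs) (y ∷ ys)
      ≡⟨ ED-∷-∷ x xs y ys ⟩
    suc (ED _≟_ xs (y ∷ ys)) ⊓ suc (ED _≟_ (x ∷ xs) ys) ⊓ (ED _≟_ xs ys + mismatch x y)
      ≡⟨ cong₂ _⊓_ (trans (cong₂ (λ a b → suc a ⊓ suc b) (ED-sym xs (y ∷ ys)) (ED-sym (x ∷ xs) ys)) (⊓-comm _ _))
                   (cong₂ _+_ (ED-sym xs ys) (mismatch-sym x y)) ⟩
    suc (ED _≟_ ys (x ∷ xs)) ⊓ suc (ED _≟_ (y ∷ ys) xs) ⊓ (ED _≟_ ys xs + mismatch y x)
      ≡⟨ ED-∷-∷ y ys x xs ⟨
    ED _≟_ (y ∷ ys) (x ∷ xs) ∎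
    where open ≡-Reasoning

  ED-lengthˡ : ∀ xs ys → length xs ≤ ED _≟_ xs ys + length ys
  ED-lengthˡ []       ys       = z≤n
  ED-lengthˡ (x ∷ xs) []       = ≤-reflexive (sym (+-identityʳ _))
  ED-lengthˡ (x ∷ xs) (y ∷ ys) = subst (λ c → suc (length xs) ≤ c + suc (length ys)) (sym (ED-∷-∷ x xs y ys))
    (⊓₃-elim (λ c → suc (length xs) ≤ c + suc (length ys))
      (s≤s (ED-lengthˡ xs (y ∷ ys)))
      (≤-trans (ED-lengthˡ (x ∷ xs) ys) (+-mono-≤ (n≤1+n _) (n≤1+n _)))
      (≤-trans (s≤s (ED-lengthˡ xs ys))
        (≤-trans (≤-reflexive (sym (+-suc _ (length ys)))) (+-monoˡ-≤ (suc (length ys)) (m≤m+n _ _)))))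

  ED-lengthʳ : ∀ xs ys → length ys ≤ ED _≟_ xs ys + length xs
  ED-lengthʳ xs ys = subst (λ c → length ys ≤ c + length xs) (ED-sym ys xs) (ED-lengthˡ ys xs)

  ED-∷ʳ : ∀ xs y ys → ED _≟_ xs (y ∷ ys) ≤ suc (ED _≟_ xs ys)
  ED-∷ʳ []       y ys = ≤-refl
  ED-∷ʳ (x ∷ xs) y ys = subst (_≤ suc (ED _≟_ (x ∷ xs) ys)) (sym (ED-∷-∷ x xs y ys))
    (≤-trans (m⊓n≤m _ _) (m⊓n≤n _ _))

  ED-++ʳ : ∀ xs V ys → ED _≟_ xs (V ++ ys) ≤ length V + ED _≟_ xs ys
  ED-++ʳ xs []      ys = ≤-refl
  ED-++ʳ xs (v ∷ V) ys = ≤-trans (ED-∷ʳ xs v (V ++ ys)) (s≤s (ED-++ʳ xs V ys))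

  ED-++-prefix : ∀ U W → ED _≟_ (U ++ W) U ≤ length W
  ED-++-prefix []      []      = ≤-refl
  ED-++-prefix []      (w ∷ W) = ≤-refl
  ED-++-prefix (u ∷ U) W = subst (_≤ length W) (sym (ED-∷-∷ u (U ++ W) u U))
    (≤-trans (m⊓n≤n _ _) (≤-trans (≤-reflexive matched) (ED-++-prefix U W)))
    where
    matched : ED _≟_ (U ++ W) U + mismatch u u ≡ ED _≟_ (U ++ W) U
    matched = trans (cong (ED _≟_ (U ++ W) U +_) (mismatch-refl u)) (+-identityʳ _)

  ED-rotate : ∀ U V W → ED _≟_ (U ++ W) (V ++ U) ≤ length V + length W
  ED-rotate U V W = ≤-trans (ED-++ʳ (U ++ W) V U) (+-monoʳ-≤ (length V) (ED-++-prefix U W))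

module ShiftAlignment {A : Set} (_≟_ : DecidableEquality A) (D : ℕ) where

  -- The cost c of aligning U[0..i) with V[0..j), where U = V[δ..), is below 2δ + i − j, with
  -- slack c + 2δ + i − j ≤ 2D bounding by D every shift reached later; each step of the
  -- edit-distance recurrence preserves both conditions.
  Cheap : (δ i j c : ℕ) → Set
  Cheap δ i j c = (c + j < 2 * δ + i) × (c + (2 * δ + i) ≤ 2 * D + j)

  cheap⇒δ≤D : ∀ {δ i j c} → Cheap δ i j c → j ≤ c + i → δ ≤ D
  cheap⇒δ≤D {δ} {i} {j} {c} (_ , within) j≤ = *-cancelˡ-≤ 2 (+-cancelʳ-≤ (c + i) (2 * δ) (2 * D) (begin
    2 * δ + (c + i)   ≡⟨ reorder δ i c ⟩
    c + (2 * δ + i)   ≤⟨ within ⟩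
    2 * D + j         ≤⟨ +-monoʳ-≤ (2 * D) j≤ ⟩
    2 * D + (c + i)   ∎))
    where
    open ≤-Reasoning
    reorder : ∀ δ i c → 2 * δ + (c + i) ≡ c + (2 * δ + i)
    reorder = solve-∀

  cheap-deletion : ∀ {δ i j c} → Cheap δ (suc i) (suc j) (suc c) → Cheap (suc δ) i (suc j) c
  cheap-deletion {δ} {i} {j} {c} (below , within) =
    <-trans (n<1+n _) (<-trans below (≤-reflexive (shift δ i))) ,
    subst (_≤ 2 * D + suc j) (move δ i c) within
    where
    shift : ∀ δ i → suc (2 * δ + suc i) ≡ 2 * suc δ + i
    shift = solve-∀
    move : ∀ δ i c → suc c + (2 * δ + suc i) ≡ c + (2 * suc δ + i)
    move = solve-∀

  cheap-insertion : ∀ {δ i j c} → Cheap (suc (suc δ)) (suc i) (suc j) (suc c) → Cheap (suc δ) (suc i) j c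
  cheap-insertion {δ} {i} {j} {c} (below , within) =
    s≤s⁻¹ (s≤s⁻¹ (subst₂ _≤_ (lhs c j) (rhs δ i) below)) ,
    ≤-trans (≤-trans (n≤1+n _) (n≤1+n _)) (s≤s⁻¹ (subst₂ _≤_ (lhs′ δ i c) (+-suc (2 * D) j) within))
    where
    lhs : ∀ c j → suc (suc c + suc j) ≡ suc (suc (suc (c + j)))
    lhs = solve-∀
    rhs : ∀ δ i → 2 * suc (suc δ) + suc i ≡ suc (suc (2 * suc δ + suc i))
    rhs = solve-∀
    lhs′ : ∀ δ i c → suc c + (2 * suc (suc δ) + suc i) ≡ suc (suc (suc (c + (2 * suc δ + suc i))))
    lhs′ = solve-∀

  cheap-insertion-at-1 : ∀ {i j c} → Cheap 1 (suc i) (suc j) (suc c) → c + j < suc i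
  cheap-insertion-at-1 {i} {j} {c} (below , _) = s≤s⁻¹ (s≤s⁻¹ (subst₂ _≤_ (lhs c j) (rhs i) below))
    where
    lhs : ∀ c j → suc (suc c + suc j) ≡ suc (suc (suc (c + j)))
    lhs = solve-∀
    rhs : ∀ i → 2 * 1 + suc i ≡ suc (suc (suc i))
    rhs = solve-∀

  cheap-substitution : ∀ {δ i j c m} → Cheap δ (suc i) (suc j) (c + m) → Cheap δ i j c
  cheap-substitution {δ} {i} {j} {c} {m} (below , within) =
    s≤s⁻¹ (≤-trans (s≤s (s≤s (+-monoˡ-≤ j (m≤m+n c m)))) (subst₂ _≤_ (lhs c m j) (+-suc (2 * δ) i) below)) ,
    s≤s⁻¹ (≤-trans (s≤s (+-monoˡ-≤ _ (m≤m+n c m))) (subst₂ _≤_ (lhs′ δ i c m) (+-suc (2 * D) j) within))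
    where
    lhs : ∀ c m j → suc (c + m + suc j) ≡ suc (suc (c + m + j))
    lhs = solve-∀
    lhs′ : ∀ δ i c m → c + m + (2 * δ + suc i) ≡ suc (c + m + (2 * δ + i))
    lhs′ = solve-∀

  cheap-window : ∀ {d N c} → c < 2 * d → 2 * d ≤ D → Cheap d N N c
  cheap-window {d} {N} {c} c<2d 2d≤D =
    +-monoˡ-< N c<2d ,
    subst (_≤ 2 * D + N) (+-assoc c (2 * d) N)
      (+-monoˡ-≤ N (≤-trans (+-mono-≤ (≤-trans (<⇒≤ c<2d) 2d≤D) 2d≤D) (≤-reflexive (double D))))
    where
    double : ∀ D → D + D ≡ 2 * D
    double = solve-∀

  AgreeThenBlocks : (V U : List A) (i k : ℕ) → Set
  AgreeThenBlocks V U i k =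
    ∃[ r ] r ≤ i × take r V ≡ take r U × BlockDecomposition≤ D (drop r (take i U)) k

  no-agreement : ∀ {V U : List A} {i k} → BlockDecomposition≤ D (take i U) k → AgreeThenBlocks V U i k
  no-agreement blocks = 0 , z≤n , refl , blocks

  agreement-periodic : ∀ {V U : List A} {δ} r → drop δ V ≡ U → 1 ≤ δ → δ ≤ D → take r V ≡ take r U →
                       BlockDecomposition≤ D (take r U) 1
  agreement-periodic {[]} {δ = δ} r shift _ _ _ =
    subst (λ Z → BlockDecomposition≤ D (take r Z) 1) (trans (sym (drop-[] δ)) shift)
      (subst (λ Z → BlockDecomposition≤ D Z 1) (sym (take-[] r)) blocks-[])
  agreement-periodic {v ∷ V} {U} {suc δ} r shift _ δ≤D agree =
    blocks-periodic (P , ≤-trans (≤-reflexive (length-take (suc δ) (v ∷ V))) (≤-trans (m⊓n≤m _ _) δ≤D) ,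
                     agreeing-shift⇒periodic P U r (s≤s z≤n) (trans (cong (take r) (sym V≡P++U)) agree))
    where
    P = take (suc δ) (v ∷ V)
    V≡P++U : v ∷ V ≡ P ++ U
    V≡P++U = trans (sym (take++drop≡id (suc δ) (v ∷ V))) (cong (P ++_) shift)

  agreement-absorbed : ∀ {V U : List A} {δ i k} → drop δ V ≡ U → 1 ≤ δ → δ ≤ D →
                       AgreeThenBlocks V U i k → BlockDecomposition≤ D (take i U) (1 + k)
  agreement-absorbed {U = U} {i = i} shift 1≤δ δ≤D (r , r≤i , agree , rest) =
    subst (λ Z → BlockDecomposition≤ D Z _) split
      (blocks-++ (agreement-periodic r shift 1≤δ δ≤D agree) rest)
    where
    split : take r U ++ drop r (take i U) ≡ take i U
    split = trans (cong (_++ drop r (take i U)) (sym (take-take-≤ U r≤i))) (take++drop≡id r (take i U))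

  prefix-length-boundˡ : ∀ {V U : List A} {i j} → i ≤ length U → j ≤ length V →
                         i ≤ ED _≟_ (take i U) (take j V) + j
  prefix-length-boundˡ {V} {U} {i} {j} i≤ j≤ =
    subst₂ (λ a b → a ≤ ED _≟_ (take i U) (take j V) + b) (length-take-≤ U i≤) (length-take-≤ V j≤)
      (ED-lengthˡ _≟_ (take i U) (take j V))

  prefix-length-boundʳ : ∀ {V U : List A} {i j} → i ≤ length U → j ≤ length V →
                         j ≤ ED _≟_ (take i U) (take j V) + i
  prefix-length-boundʳ {V} {U} {i} {j} i≤ j≤ =
    subst₂ (λ a b → a ≤ ED _≟_ (take i U) (take j V) + b) (length-take-≤ V j≤) (length-take-≤ U i≤)
      (ED-lengthʳ _≟_ (take i U) (take j V))

  cheap-alignment⇒agree-then-blocks :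
    ∀ (V U : List A) δ i j → drop δ V ≡ U → 1 ≤ δ → i ≤ length U → j ≤ length V →
    let c = ED _≟_ (take i U) (take j V) in Cheap δ i j c → AgreeThenBlocks V U i (2 * c)
  cheap-alignment⇒agree-then-blocks V U δ zero j _ _ _ _ _ = 0 , z≤n , refl , blocks-[]
  cheap-alignment⇒agree-then-blocks V [] δ (suc i) j _ _ () _ _
  cheap-alignment⇒agree-then-blocks V (x ∷ W) δ (suc i) zero _ 1≤δ _ _ cheap =
    no-agreement (blocks-mono (m≤m+n _ _) (blocks-singletons (≤-trans 1≤δ (cheap⇒δ≤D cheap z≤n)) (x ∷ take i W)))
  cheap-alignment⇒agree-then-blocks [] (x ∷ W) δ (suc i) (suc j) _ _ _ () _
  cheap-alignment⇒agree-then-blocks (v ∷ V) (x ∷ W) δ (suc i) (suc j) shift 1≤δ (s≤s i≤) (s≤s j≤) =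
    subst (Covered δ) (sym (ED-∷-∷ _≟_ x (take i W) v (take j V)))
      (⊓₃-elim (Covered δ) deletion (insertion shift 1≤δ) substitution)
    where
    Covered : ℕ → ℕ → Set
    Covered δ c = Cheap δ (suc i) (suc j) c → AgreeThenBlocks (v ∷ V) (x ∷ W) (suc i) (2 * c)

    c-del = ED _≟_ (take i W) (v ∷ take j V)
    c-ins = ED _≟_ (x ∷ take i W) (take j V)
    c-sub = ED _≟_ (take i W) (take j V)

    restart : ∀ c → 1 + (1 + 2 * c) ≡ 2 * suc c
    restart = solve-∀

    deletion : Covered δ (suc c-del)
    deletion cheap =
      no-agreement (blocks-mono (≤-reflexive (restart c-del))
        (blocks-++ {Z₁ = x ∷ []} (blocks-short (x ∷ []) (≤-trans (s≤s z≤n) δ+1≤D))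
                                 (agreement-absorbed shift′ (s≤s z≤n) δ+1≤D rest)))
      where
      shift′ = drop-suc-∷ δ (v ∷ V) shift
      cheap′ = cheap-deletion cheap
      rest = cheap-alignment⇒agree-then-blocks (v ∷ V) W (suc δ) i (suc j) shift′ (s≤s z≤n) i≤ (s≤s j≤) cheap′
      δ+1≤D = cheap⇒δ≤D cheap′ (prefix-length-boundʳ {v ∷ V} {W} i≤ (s≤s j≤))

    insertion : ∀ {δ} → drop δ (v ∷ V) ≡ x ∷ W → 1 ≤ δ → Covered δ (suc c-ins)
    insertion {suc zero} _ _ cheap =
      ⊥-elim (<⇒≱ (cheap-insertion-at-1 cheap) (prefix-length-boundˡ {V} {x ∷ W} (s≤s i≤) j≤))
    insertion {suc (suc δ)} shift _ cheap =
      no-agreement (blocks-mono (≤-trans (n≤1+n _) (≤-reflexive (restart c-ins)))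
        (agreement-absorbed shift (s≤s z≤n) δ+1≤D rest))
      where
      cheap′ = cheap-insertion cheap
      rest = cheap-alignment⇒agree-then-blocks V (x ∷ W) (suc δ) (suc i) j shift (s≤s z≤n) (s≤s i≤) j≤ cheap′
      δ+1≤D = cheap⇒δ≤D cheap′ (prefix-length-boundʳ {V} {x ∷ W} (s≤s i≤) j≤)

    tails-shift : drop δ V ≡ W
    tails-shift = drop-∷-∷ 1≤δ shift

    substitution : Covered δ (c-sub + mismatch _≟_ x v)
    substitution cheap
      with x ≟ v | cheap-alignment⇒agree-then-blocks V W δ i j tails-shift 1≤δ i≤ j≤ (cheap-substitution {δ} {i} {j} {c-sub} cheap)
    ... | yes x≡v | r , r≤i , agree , rest =
      suc r , s≤s r≤i , cong₂ _∷_ (sym x≡v) agree ,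
      subst (λ c → BlockDecomposition≤ D (drop r (take i W)) (2 * c)) (sym (+-identityʳ c-sub)) rest
    ... | no _ | rest =
      no-agreement (blocks-mono (≤-reflexive (trans (restart c-sub) (cong (2 *_) (+-comm 1 c-sub))))
        (blocks-++ {Z₁ = x ∷ []} (blocks-short (x ∷ []) (≤-trans 1≤δ δ≤D))
                                 (agreement-absorbed tails-shift 1≤δ δ≤D rest)))
      where δ≤D = cheap⇒δ≤D (cheap-substitution {δ} {i} {j} {c-sub} cheap) (prefix-length-boundʳ {V} {W} i≤ j≤)

block-count-bound : ∀ {K d c} → 1 ≤ K → d ≤ K + K → c < 2 * d → 1 + ((1 + 2 * c) + 1) ≤ 10 * K
block-count-bound {K} {d} {c} 1≤K d≤2K c<2d = begin
  1 + ((1 + 2 * c) + 1)     ≡⟨ regroup c ⟩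
  1 + 2 * suc c             ≤⟨ +-mono-≤ 1≤K (*-monoʳ-≤ 2 (≤-trans c<2d (*-monoʳ-≤ 2 d≤2K))) ⟩
  K + 2 * (2 * (K + K))     ≤⟨ m≤m+n _ K ⟩
  K + 2 * (2 * (K + K)) + K ≡⟨ ten K ⟩
  10 * K                    ∎
  where
  open ≤-Reasoning
  regroup : ∀ c → 1 + ((1 + 2 * c) + 1) ≡ 1 + 2 * suc c
  regroup = solve-∀
  ten : ∀ K → K + 2 * (2 * (K + K)) + K ≡ 10 * K
  ten = solve-∀

module _ {A : Set} (_≟_ : DecidableEquality A) where

  open ShiftAlignment _≟_

  ≤-length-drop : ∀ (V : List A) d N → d + N ≤ length V → N ≤ length (drop d V)
  ≤-length-drop V d N d+N≤ =
    subst (N ≤_) (sym (length-drop d V)) (m+n≤o⇒m≤o∸n N (subst (_≤ length V) (+-comm d N) d+N≤))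

  window-shift-upper : ∀ (V : List A) d N → d ≤ N → d + N ≤ length V →
                       ED _≟_ (take N (drop d V)) (take N V) ≤ 2 * d
  window-shift-upper V d N d≤N d+N≤ = begin
    ED _≟_ (take N U) (take N V)   ≡⟨ cong₂ (ED _≟_) U-window V-window ⟩
    ED _≟_ (U₀ ++ W₀) (V₀ ++ U₀)   ≤⟨ ED-rotate _≟_ U₀ V₀ W₀ ⟩
    length V₀ + length W₀          ≡⟨ cong₂ _+_ |V₀|≡d |W₀|≡d ⟩
    d + d                          ≡⟨ cong (d +_) (+-identityʳ d) ⟨
    2 * d                          ∎
    where
    open ≤-Reasoning
    U = drop d V
    M = N ∸ d
    U₀ = take M U
    V₀ = take d V
    W₀ = drop M (take N U)
    N≤|U| = ≤-length-drop V d N d+N≤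
    |V₀|≡d : length V₀ ≡ d
    |V₀|≡d = length-take-≤ V (≤-trans (m≤m+n d N) d+N≤)
    |W₀|≡d : length W₀ ≡ d
    |W₀|≡d = trans (length-drop M (take N U)) (trans (cong (_∸ M) (length-take-≤ U N≤|U|)) (m∸[m∸n]≡n d≤N))
    U-window : take N U ≡ U₀ ++ W₀
    U-window = trans (sym (take++drop≡id M (take N U))) (cong (_++ W₀) (take-take-≤ U (m∸n≤m N d)))
    V-window : take N V ≡ V₀ ++ U₀
    V-window = trans (cong (take N) (sym (take++drop≡id d V)))
      (trans (cong (λ n → take n (V₀ ++ U)) (sym (trans (cong (_+ M) |V₀|≡d) (m+[n∸m]≡n d≤N))))
             (take-length+-++ V₀ U M))

  cheap-window⇒blocks : ∀ D (V : List A) d N → 1 ≤ d → 2 * d ≤ D → d + N ≤ length V →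
    let c = ED _≟_ (take N (drop d V)) (take N V) in
    c < 2 * d → BlockDecomposition≤ D (take N (drop d V)) (1 + 2 * c)
  cheap-window⇒blocks D V d N 1≤d 2d≤D d+N≤ c<2d =
    agreement-absorbed D refl 1≤d d≤D
      (cheap-alignment⇒agree-then-blocks D V (drop d V) d N N refl 1≤d
        (≤-length-drop V d N d+N≤) (≤-trans (m≤n+m N d) d+N≤) (cheap-window D {d} c<2d 2d≤D))
    where d≤D = ≤-trans (m≤m+n d (d + 0)) 2d≤D

  window-room : ∀ (Y : List A) N M t d → length Y ≡ N + M → t + d ≤ M → d + N ≤ length (drop t Y)
  window-room Y N M t d |Y|≡ t+d≤M = begin
    d + N             ≤⟨ +-monoˡ-≤ N (m+n≤o⇒m≤o∸n d (subst (_≤ M) (+-comm t d) t+d≤M)) ⟩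
    (M ∸ t) + N       ≡⟨ +-comm (M ∸ t) N ⟩
    N + (M ∸ t)       ≡⟨ +-∸-assoc N (≤-trans (m≤m+n t d) t+d≤M) ⟨
    (N + M) ∸ t       ≡⟨ cong (_∸ t) |Y|≡ ⟨
    length Y ∸ t      ≡⟨ length-drop t Y ⟨
    length (drop t Y) ∎
    where open ≤-Reasoning

  window-suffix-short : ∀ (Y : List A) N M s → length Y ≡ N + M → length (drop N (drop s Y)) ≤ M
  window-suffix-short Y N M s |Y|≡ = begin
    length (drop N (drop s Y))   ≡⟨ trans (length-drop N (drop s Y)) (cong (_∸ N) (length-drop s Y)) ⟩
    (length Y ∸ s) ∸ N           ≤⟨ ∸-monoˡ-≤ N (m∸n≤m (length Y) s) ⟩
    length Y ∸ N                 ≡⟨ cong (_∸ N) |Y|≡ ⟩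
    (N + M) ∸ N                  ≡⟨ m+n∸m≡n N M ⟩
    M                            ∎
    where open ≤-Reasoning

  window-shift-lower : ∀ (Y : List A) K N t d bp → 1 ≤ K → length Y ≡ N + (K + K) → t + d ≤ K + K →
    IsBlockPeriodicity (4 * K) Y bp → 10 * K < bp →
    2 * d ≤ ED _≟_ (take N (drop d (drop t Y))) (take N (drop t Y))
  window-shift-lower Y K N t zero    bp _ _ _ _ _ = z≤n
  window-shift-lower Y K N t (suc d) bp 1≤K |Y|≡ t+d≤ isBp bp>10K
    with 2 * suc d ≤? ED _≟_ (take N (drop (suc d) (drop t Y))) (take N (drop t Y))
  ... | yes cost≥ = cost≥
  ... | no cost≱ = ⊥-elim (<⇒≱ bp>10K (≤-trans (block-periodicity-minimal isBp whole) (block-count-bound 1≤K d≤2K c<2d)))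
    where
    V = drop t Y
    U = drop (suc d) V
    c = ED _≟_ (take N U) (take N V)
    c<2d = ≰⇒> cost≱
    2K≤4K : K + K ≤ 4 * K
    2K≤4K = ≤-trans (m≤m+n (K + K) (K + K)) (≤-reflexive (four K))
      where
      four : ∀ K → (K + K) + (K + K) ≡ 4 * K
      four = solve-∀
    d≤2K = ≤-trans (m≤n+m (suc d) t) t+d≤
    U≡ : U ≡ drop (t + suc d) Y
    U≡ = drop-drop t (suc d) Y
    prefix : BlockDecomposition≤ (4 * K) (take (t + suc d) Y) 1
    prefix = blocks-short (take (t + suc d) Y)
      (≤-trans (≤-reflexive (length-take (t + suc d) Y)) (≤-trans (m⊓n≤m _ _) (≤-trans t+d≤ 2K≤4K)))
    window : BlockDecomposition≤ (4 * K) (take N U) (1 + 2 * c)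
    window = cheap-window⇒blocks (4 * K) V (suc d) N (s≤s z≤n)
      (≤-trans (*-monoʳ-≤ 2 d≤2K) (≤-reflexive (double K))) (window-room Y N (K + K) t (suc d) |Y|≡ t+d≤) c<2d
      where
      double : ∀ K → 2 * (K + K) ≡ 4 * K
      double = solve-∀
    suffix : BlockDecomposition≤ (4 * K) (drop N U) 1
    suffix = blocks-short (drop N U)
      (≤-trans (subst (λ Z → length (drop N Z) ≤ K + K) (sym U≡) (window-suffix-short Y N (K + K) (t + suc d) |Y|≡)) 2K≤4K)
    pieces : take (t + suc d) Y ++ (take N U ++ drop N U) ≡ Y
    pieces = trans (cong (take (t + suc d) Y ++_) (trans (take++drop≡id N U) U≡)) (take++drop≡id (t + suc d) Y)
    whole : BlockDecomposition≤ (4 * K) Y (1 + ((1 + 2 * c) + 1))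
    whole = subst (λ Z → BlockDecomposition≤ (4 * K) Z (1 + ((1 + 2 * c) + 1))) pieces (blocks-++ prefix (blocks-++ window suffix))

  window-shift-ED : ∀ (Y : List A) K N t d bp → 1 ≤ K → length Y ≡ N + (K + K) → t + d ≤ K + K → K + K ≤ N →
    IsBlockPeriodicity (4 * K) Y bp → 10 * K < bp →
    ED _≟_ (take N (drop (t + d) Y)) (take N (drop t Y)) ≡ 2 * d
  window-shift-ED Y K N t d bp 1≤K |Y|≡ t+d≤ 2K≤N isBp bp>10K =
    subst (λ U → ED _≟_ (take N U) (take N (drop t Y)) ≡ 2 * d) (drop-drop t d Y)
      (≤-antisym
        (window-shift-upper (drop t Y) d N (≤-trans (≤-trans (m≤n+m d t) t+d≤) 2K≤N) (window-room Y N (K + K) t d |Y|≡ t+d≤))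
        (window-shift-lower Y K N t d bp 1≤K |Y|≡ t+d≤ isBp bp>10K))

  windows-ED : ∀ (Y : List A) K N t t′ bp → 1 ≤ K → length Y ≡ N + (K + K) → t ≤ K + K → t′ ≤ K + K → K + K ≤ N →
    IsBlockPeriodicity (4 * K) Y bp → 10 * K < bp →
    ED _≟_ (take N (drop t Y)) (take N (drop t′ Y)) ≡ 2 * ∣ t - t′ ∣
  windows-ED Y K N t t′ bp 1≤K |Y|≡ t≤ t′≤ 2K≤N isBp bp>10K =
    [ (λ t′≤t → oriented t′≤t t≤)
    , (λ t≤t′ → trans (ED-sym _≟_ (take N (drop t Y)) (take N (drop t′ Y)))
                      (trans (oriented t≤t′ t′≤) (cong (2 *_) (∣-∣-comm t′ t))))
    ]′ (≤-total t′ t)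
    where
    oriented : ∀ {t t′} → t′ ≤ t → t ≤ K + K → ED _≟_ (take N (drop t Y)) (take N (drop t′ Y)) ≡ 2 * ∣ t - t′ ∣
    oriented {t} {t′} t′≤t t≤ =
      subst (λ t → ED _≟_ (take N (drop t Y)) (take N (drop t′ Y)) ≡ 2 * ∣ t - t′ ∣) (m+[n∸m]≡n t′≤t)
        (trans (window-shift-ED Y K N t′ d bp 1≤K |Y|≡ (subst (_≤ K + K) (sym (m+[n∸m]≡n t′≤t)) t≤) 2K≤N isBp bp>10K)
               (cong (2 *_) (sym (trans (∣-∣-comm (t′ + d) t′) (∣m-m+n∣≡n t′ d)))))
      where d = t ∸ t′

  length-if-block-periodic : ∀ (Y : List A) K bp → 1 ≤ K → IsBlockPeriodicity (4 * K) Y bp → 10 * K < bp →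
                             (K + K) + (K + K) ≤ length Y
  length-if-block-periodic Y K bp 1≤K isBp bp>10K = begin
    (K + K) + (K + K)            ≤⟨ m≤m+n _ (6 * K) ⟩
    (K + K) + (K + K) + 6 * K    ≡⟨ ten K ⟩
    10 * K                       ≤⟨ <⇒≤ bp>10K ⟩
    bp                           ≤⟨ block-periodicity≤length (≤-trans 1≤K (m≤m+n K (3 * K))) isBp ⟩
    length Y                     ∎
    where
    open ≤-Reasoning
    ten : ∀ K → (K + K) + (K + K) + 6 * K ≡ 10 * K
    ten = solve-∀

window-start : ℕ → ℤ → ℕ
window-start K s = ∣ ℤ.+ K ℤ.+ s ∣

module _ (K : ℕ) {s : ℤ} (-K≤s : ℤ.- ℤ.+ K ℤ.≤ s) where

  +window-start : ℤ.+ window-start K s ≡ ℤ.+ K ℤ.+ s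
  +window-start = ℤ.0≤i⇒+∣i∣≡i (subst (ℤ.0ℤ ℤ.≤_) (cancel (ℤ.+ K) s) (ℤ.i≤j⇒0≤j-i -K≤s))
    where
    cancel : ∀ k s → s ℤ.- ℤ.- k ≡ k ℤ.+ s
    cancel = ℤ-solve-∀

  window-start≤ : s ℤ.≤ ℤ.+ K → window-start K s ≤ K + K
  window-start≤ s≤K = ℤ.drop‿+≤+ (subst₂ ℤ._≤_ (sym +window-start) (sym (ℤ.pos-+ K K)) (ℤ.+-monoʳ-≤ (ℤ.+ K) s≤K))

  shifted-window : ∀ {A : Set} (Y : List A) N → length Y ≡ N + (K + K) →
                   shifted Y K s ≡ take N (drop (window-start K s) Y)
  shifted-window Y N |Y|≡ = cong (λ n → take n (drop t Y)) (trans (cong (λ e → ∣ e ∣ ∸ t) end) (m+n∸n≡m N t))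
    where
    t = window-start K s
    regroup : ∀ n k s → (n ℤ.+ (k ℤ.+ k)) ℤ.- k ℤ.+ s ≡ n ℤ.+ (k ℤ.+ s)
    regroup = ℤ-solve-∀
    +length : ℤ.+ length Y ≡ ℤ.+ N ℤ.+ (ℤ.+ K ℤ.+ ℤ.+ K)
    +length = trans (cong ℤ.+_ |Y|≡) (trans (ℤ.pos-+ N (K + K)) (cong (ℤ._+_ (ℤ.+ N)) (ℤ.pos-+ K K)))
    end : (ℤ.+ length Y ℤ.- ℤ.+ K) ℤ.+ s ≡ ℤ.+ (N + t)
    end = begin
      (ℤ.+ length Y ℤ.- ℤ.+ K) ℤ.+ s                 ≡⟨ cong (λ n → (n ℤ.- ℤ.+ K) ℤ.+ s) +length ⟩
      (ℤ.+ N ℤ.+ (ℤ.+ K ℤ.+ ℤ.+ K)) ℤ.- ℤ.+ K ℤ.+ s  ≡⟨ regroup (ℤ.+ N) (ℤ.+ K) s ⟩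
      ℤ.+ N ℤ.+ (ℤ.+ K ℤ.+ s)                         ≡⟨ cong (ℤ._+_ (ℤ.+ N)) +window-start ⟨
      ℤ.+ N ℤ.+ ℤ.+ t                                 ≡⟨ ℤ.pos-+ N t ⟨
      ℤ.+ (N + t)                                     ∎
      where open ≡-Reasoning

window-start-distance : ∀ K {s s′} (-K≤s : ℤ.- ℤ.+ K ℤ.≤ s) (-K≤s′ : ℤ.- ℤ.+ K ℤ.≤ s′) →
                        ∣ window-start K s - window-start K s′ ∣ ≡ ∣ s ℤ.- s′ ∣
window-start-distance K {s} {s′} -K≤s -K≤s′ = begin
  ∣ t - t′ ∣                          ≡⟨ ∣m⊖n∣≡∣m-n∣ t t′ ⟨
  ∣ t ⊖ t′ ∣                          ≡⟨ cong ∣_∣ (ℤ.[+m]-[+n]≡m⊖n t t′) ⟨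
  ∣ ℤ.+ t ℤ.- ℤ.+ t′ ∣                ≡⟨ cong₂ (λ a b → ∣ a ℤ.- b ∣) (+window-start K -K≤s) (+window-start K -K≤s′) ⟩
  ∣ (ℤ.+ K ℤ.+ s) ℤ.- (ℤ.+ K ℤ.+ s′) ∣ ≡⟨ cong ∣_∣ (cancel (ℤ.+ K) s s′) ⟩
  ∣ s ℤ.- s′ ∣                        ∎
  where
  open ≡-Reasoning
  t = window-start K s
  t′ = window-start K s′
  cancel : ∀ k s s′ → (k ℤ.+ s) ℤ.- (k ℤ.+ s′) ≡ s ℤ.- s′
  cancel = ℤ-solve-∀

lemma13 : {A : Set} (_≟_ : DecidableEquality A) (Y : List A) (K : ℕ) →
    1 ≤ K → (bp : ℕ) → IsBlockPeriodicity (4 * K) Y bp → 10 * K < bp →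
    (s s′ : ℤ) → ℤ.- ℤ.+ K ℤ.≤ s → s ℤ.≤ ℤ.+ K → ℤ.- ℤ.+ K ℤ.≤ s′ → s′ ℤ.≤ ℤ.+ K →
    ED _≟_ (shifted Y K s) (shifted Y K s′) ≡ 2 * ∣ s ℤ.- s′ ∣
lemma13 _≟_ Y K 1≤K bp isBp bp>10K s s′ -K≤s s≤K -K≤s′ s′≤K = begin
  ED _≟_ (shifted Y K s) (shifted Y K s′)
    ≡⟨ cong₂ (ED _≟_) (shifted-window K -K≤s Y N |Y|≡) (shifted-window K -K≤s′ Y N |Y|≡) ⟩
  ED _≟_ (take N (drop t Y)) (take N (drop t′ Y))
    ≡⟨ windows-ED _≟_ Y K N t t′ bp 1≤K |Y|≡ (window-start≤ K -K≤s s≤K) (window-start≤ K -K≤s′ s′≤K)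
                  2K≤N isBp bp>10K ⟩
  2 * ∣ t - t′ ∣
    ≡⟨ cong (2 *_) (window-start-distance K -K≤s -K≤s′) ⟩
  2 * ∣ s ℤ.- s′ ∣ ∎
  where
  open ≡-Reasoning
  t = window-start K s
  t′ = window-start K s′
  N = length Y ∸ (K + K)
  4K≤|Y| = length-if-block-periodic _≟_ Y K bp 1≤K isBp bp>10K
  |Y|≡ : length Y ≡ N + (K + K)
  |Y|≡ = sym (m∸n+n≡m (≤-trans (m≤m+n (K + K) (K + K)) 4K≤|Y|))
  2K≤N : K + K ≤ N
  2K≤N = m+n≤o⇒m≤o∸n (K + K) 4K≤|Y|
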